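{- Let $G_S$ be the self-loop $4$-cycle with exactly one loop: its vertices are $u,a,w,b$, its edges are $ua, aw, wb, bu$, and there is a single loop at $u$. (Thus $\{a,b\}$ is the independent set of loopless vertices of $G_S$ adjacent to the looped vertex, and $\{u,w\}$ is its complement.) Consider graphs $H$ obtained from $G_S$ by adding a finite set $W$ of new vertices which carry no loops and are pairwise non-adjacent, each new vertex being joined by edges to at least one vertex of $G_S$ (so $H$ is connected, contains a cycle, and has exactly one loop). Then, up to isomorphism, the graphs $H$ of this form which are triangle-free and have rank $3$ are exactly (1) $H_1$: every vertex of $W$ is adjacent to exactly $a$ and $b$ (the join of $G_S$ with $W$ over $\{a,b\}$), and (2) $H_2$: every vertex of $W$ is adjacent to exactly $u$ and $w$ (the join of $G_S$ with $W$ over $\{u,w\}$).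
   Context: A self-loop graph is a simple graph with a self-loop attached at each vertex of some subset $S$ of its vertices. Its adjacency matrix $A=(a_{ij})$ has $a_{ij}=1$ if $v_i$ and $v_j$ are joined by an edge (for $i\neq j$) or $v_i$ carries a loop (for $i=j$), and $a_{ij}=0$ otherwise; the rank of the graph is the rank of this matrix over $\mathbb{R}$. A triangle is a set of three distinct, pairwise adjacent vertices (loops are irrelevant). For a graph $G_1$, a subset $A\subseteq V(G_1)$ and a disjoint graph $G_2$, the join of $G_1$ and $G_2$ over $A$ is obtained from their disjoint union by joining every vertex of $A$ to every vertex of $G_2$, and no vertex of $V(G_1)\setminus A$ to any vertex of $G_2$. -}

module Defs where

open import Data.Nat using (ℕ; zero; suc; _+_)
open import Data.Fin using (Fin; zero; suc; splitAt)
open import Data.Bool using (Bool; true; false)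
open import Data.Sum using (_⊎_; inj₁; inj₂)
open import Data.Product using (Σ; _×_)
open import Data.Rational using (ℚ; 0ℚ; 1ℚ) renaming (_+_ to _+ℚ_; _*_ to _*ℚ_)
open import Relation.Binary.PropositionalEquality using (_≡_; _≢_)
open import Relation.Nullary using (¬_)

-- Linear algebra over ℚ (rank of a rational matrix; equals the rank over ℝ)

sumℚ : ∀ {r} → (Fin r → ℚ) → ℚ
sumℚ {zero}  f = 0ℚ
sumℚ {suc r} f = f zero +ℚ sumℚ (λ i → f (suc i))

LinIndep : ∀ {r n} → (Fin r → Fin n → ℚ) → Set
LinIndep {r} {n} v =
  (c : Fin r → ℚ) →
  (∀ (j : Fin n) → sumℚ (λ i → c i *ℚ v i j) ≡ 0ℚ) →
  ∀ (i : Fin r) → c i ≡ 0ℚ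

HasRank : ∀ {n} → (Fin n → Fin n → ℚ) → ℕ → Set
HasRank {n} A r =
  Σ (Fin r → Fin n) (λ σ → LinIndep (λ i → A (σ i)))
  × ((σ : Fin (suc r) → Fin n) → ¬ LinIndep (λ i → A (σ i)))

-- Graphs with loops, given by a symmetric Bool adjacency matrix
-- (diagonal entry true = loop).

b2q : Bool → ℚ
b2q true  = 1ℚ
b2q false = 0ℚ

adjMatrixℚ : ∀ {n} → (Fin n → Fin n → Bool) → Fin n → Fin n → ℚ
adjMatrixℚ adj i j = b2q (adj i j)

rankIs : ∀ {n} → (Fin n → Fin n → Bool) → ℕ → Set
rankIs adj r = HasRank (adjMatrixℚ adj) r

TriangleFree : ∀ {n} → (Fin n → Fin n → Bool) → Set
TriangleFree {n} adj =
  ∀ (x y z : Fin n) → x ≢ y → y ≢ z → x ≢ z →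
  ¬ (adj x y ≡ true × adj y z ≡ true × adj x z ≡ true)

-- G_S: vertices 0 = u, 1 = a, 2 = w, 3 = b; edges ua, aw, wb, bu; loop at u.

vu va vw vb : Fin 4
vu = zero
va = suc zero
vw = suc (suc zero)
vb = suc (suc (suc zero))

gS : Fin 4 → Fin 4 → Bool
gS zero zero = true
gS zero (suc zero) = true
gS zero (suc (suc zero)) = false
gS zero (suc (suc (suc zero))) = true
gS (suc zero) zero = true
gS (suc zero) (suc zero) = false
gS (suc zero) (suc (suc zero)) = true
gS (suc zero) (suc (suc (suc zero))) = false
gS (suc (suc zero)) zero = false
gS (suc (suc zero)) (suc zero) = true
gS (suc (suc zero)) (suc (suc zero)) = false
gS (suc (suc zero)) (suc (suc (suc zero))) = true
gS (suc (suc (suc zero))) zero = true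
gS (suc (suc (suc zero))) (suc zero) = false
gS (suc (suc (suc zero))) (suc (suc zero)) = true
gS (suc (suc (suc zero))) (suc (suc (suc zero))) = false

-- The graph H: vertex set Fin (4 + k); the first 4 vertices are G_S, the
-- remaining k form W (loopless, pairwise non-adjacent); N i is the set of
-- G_S-vertices adjacent to the i-th vertex of W.
adjSum : ∀ {k} → (Fin k → Fin 4 → Bool) → Fin 4 ⊎ Fin k → Fin 4 ⊎ Fin k → Bool
adjSum N (inj₁ p) (inj₁ q) = gS p q
adjSum N (inj₁ p) (inj₂ j) = N j p
adjSum N (inj₂ i) (inj₁ q) = N i q
adjSum N (inj₂ i) (inj₂ j) = false

adjH : ∀ {k} → (Fin k → Fin 4 → Bool) → Fin (4 + k) → Fin (4 + k) → Bool
adjH N x y = adjSum N (splitAt 4 x) (splitAt 4 y)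

setAB : Fin 4 → Bool
setAB zero = false
setAB (suc zero) = true
setAB (suc (suc zero)) = false
setAB (suc (suc (suc zero))) = true

setUW : Fin 4 → Bool
setUW zero = true
setUW (suc zero) = false
setUW (suc (suc zero)) = true
setUW (suc (suc (suc zero))) = false

-- Triangle-freeness forbids x to see a vertex of {u, w}
-- together with one of {a, b}, so its neighbourhood is a nonempty subset of {a, b} or of {u, w}.
-- A single neighbour, or two new vertices of the two different kinds, would give four rows of the
-- adjacency matrix in echelon form, hence rank at least 4. Conversely, in H₁ (resp. H₂) every new
-- vertex is a false twin of w (resp. a), so H collapses onto G_S: the bipartition of the 4-cycle
-- pulls back to H, and every row of H is the row of u, a or w, which are independent.
module Submission where

open import Defs
open import Data.Bool using (Bool; true; false; not)
import Data.Bool.Properties as Bool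
open import Data.Empty using (⊥; ⊥-elim)
open import Data.Fin using (Fin; zero; suc; splitAt; join; _↑ˡ_)
open import Data.Fin.Patterns using (0F; 1F; 2F; 3F; 4F; 5F)
open import Data.Fin.Properties
  using (_≟_; suc-injective; pigeonhole; <⇒≢; all?; splitAt-join; join-splitAt)
open import Data.Nat using (ℕ; zero; suc; _+_)
open import Data.Nat.Properties using (n<1+n)
open import Data.Product using (Σ; _×_; _,_)
open import Data.Rational using (ℚ; 0ℚ; 1ℚ; -_; _-_) renaming (_+_ to _+ℚ_; _*_ to _*ℚ_)
import Data.Rational.Properties as ℚ
open import Data.Sum as Sum using (_⊎_; inj₁; inj₂)
open import Data.Sum.Properties using (inj₂-injective)
open import Data.Unit using (⊤; tt)
open import Data.Vec using (_∷_; []; lookup)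
open import Function using (_∘_; id)
open import Function.Bundles using (_⇔_; mk⇔)
open import Relation.Binary.PropositionalEquality
open import Relation.Nullary using (¬_; Dec; yes; does; _×-dec_; contradiction)
open import Relation.Nullary.Decidable using (dec-true; dec-false; True; toWitness)

sumℚ-cong : ∀ {n} {f g : Fin n → ℚ} → (∀ i → f i ≡ g i) → sumℚ f ≡ sumℚ g
sumℚ-cong {zero}  f≗g = refl
sumℚ-cong {suc n} f≗g = cong₂ _+ℚ_ (f≗g zero) (sumℚ-cong (f≗g ∘ suc))

sumℚ-zero : ∀ {n} (f : Fin n → ℚ) → (∀ i → f i ≡ 0ℚ) → sumℚ f ≡ 0ℚ
sumℚ-zero {zero}  f f≗0 = refl
sumℚ-zero {suc n} f f≗0 =
  trans (cong₂ _+ℚ_ (f≗0 zero) (sumℚ-zero (f ∘ suc) (f≗0 ∘ suc))) (ℚ.+-identityˡ 0ℚ)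

sumℚ-single : ∀ {n} (f : Fin n → ℚ) i → (∀ k → k ≢ i → f k ≡ 0ℚ) → sumℚ f ≡ f i
sumℚ-single f zero    off = begin
  f zero +ℚ sumℚ (f ∘ suc)
    ≡⟨ cong (f zero +ℚ_) (sumℚ-zero (f ∘ suc) (λ k → off (suc k) λ ())) ⟩
  f zero +ℚ 0ℚ
    ≡⟨ ℚ.+-identityʳ (f zero) ⟩
  f zero ∎
  where open ≡-Reasoning
sumℚ-single f (suc i) off = begin
  f zero +ℚ sumℚ (f ∘ suc)
    ≡⟨ cong₂ _+ℚ_ (off zero λ ())
             (sumℚ-single (f ∘ suc) i λ k k≢i → off (suc k) (k≢i ∘ suc-injective)) ⟩
  0ℚ +ℚ f (suc i)
    ≡⟨ ℚ.+-identityˡ (f (suc i)) ⟩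
  f (suc i) ∎
  where open ≡-Reasoning

sumℚ-pair : ∀ {n} (f : Fin n → ℚ) {i j} → i ≢ j → (∀ k → k ≢ i → k ≢ j → f k ≡ 0ℚ) →
  sumℚ f ≡ f i +ℚ f j
sumℚ-pair f {zero}  {zero}  i≢j off = ⊥-elim (i≢j refl)
sumℚ-pair f {zero}  {suc j} i≢j off =
  cong (f zero +ℚ_) (sumℚ-single (f ∘ suc) j λ k k≢j → off (suc k) (λ ()) (k≢j ∘ suc-injective))
sumℚ-pair f {suc i} {zero}  i≢j off =
  trans (cong (f zero +ℚ_) (sumℚ-single (f ∘ suc) i λ k k≢i → off (suc k) (k≢i ∘ suc-injective) (λ ())))
        (ℚ.+-comm (f zero) (f (suc i)))
sumℚ-pair f {suc i} {suc j} i≢j off =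
  trans (cong₂ _+ℚ_ (off zero (λ ()) (λ ()))
                    (sumℚ-pair (f ∘ suc) (i≢j ∘ cong suc)
                       (λ k k≢i k≢j → off (suc k) (k≢i ∘ suc-injective) (k≢j ∘ suc-injective))))
        (ℚ.+-identityˡ (f (suc i) +ℚ f (suc j)))

¬LinIndep-equalRows : ∀ {m n} (M : Fin m → Fin n → ℚ) {i j} → i ≢ j →
  (∀ col → M i col ≡ M j col) → ¬ LinIndep M
¬LinIndep-equalRows M {i} {j} i≢j Mᵢ≗Mⱼ indep = ℚ.1≢0 (trans (sym cᵢ≡1) (indep c dependence i))
  where
  open ≡-Reasoning
  c : Fin _ → ℚ
  c k = b2q (does (k ≟ i)) - b2q (does (k ≟ j))
  cᵢ≡1 : c i ≡ 1ℚ
  cᵢ≡1 rewrite dec-true (i ≟ i) refl | dec-false (i ≟ j) i≢j = refl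
  cⱼ≡-1 : c j ≡ - 1ℚ
  cⱼ≡-1 rewrite dec-false (j ≟ i) (i≢j ∘ sym) | dec-true (j ≟ j) refl = refl
  c-off : ∀ k → k ≢ i → k ≢ j → c k ≡ 0ℚ
  c-off k k≢i k≢j rewrite dec-false (k ≟ i) k≢i | dec-false (k ≟ j) k≢j = refl
  dependence : ∀ col → sumℚ (λ k → c k *ℚ M k col) ≡ 0ℚ
  dependence col = begin
    sumℚ (λ k → c k *ℚ M k col)
      ≡⟨ sumℚ-pair _ i≢j (λ k k≢i k≢j → trans (cong (_*ℚ M k col) (c-off k k≢i k≢j))
                                              (ℚ.*-zeroˡ (M k col))) ⟩
    c i *ℚ M i col +ℚ c j *ℚ M j col
      ≡⟨ cong (c i *ℚ M i col +ℚ_) (cong (c j *ℚ_) (Mᵢ≗Mⱼ col)) ⟨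
    c i *ℚ M i col +ℚ c j *ℚ M i col
      ≡⟨ cong₂ (λ a b → a *ℚ M i col +ℚ b *ℚ M i col) cᵢ≡1 cⱼ≡-1 ⟩
    1ℚ *ℚ M i col +ℚ (- 1ℚ) *ℚ M i col
      ≡⟨ ℚ.*-distribʳ-+ (M i col) 1ℚ (- 1ℚ) ⟨
    0ℚ *ℚ M i col
      ≡⟨ ℚ.*-zeroˡ (M i col) ⟩
    0ℚ ∎

¬LinIndep-rowsFactorThrough : ∀ {m n r} (M : Fin m → Fin n → ℚ) (cls : Fin m → Fin r) →
  (∀ x y → cls x ≡ cls y → ∀ col → M x col ≡ M y col) →
  (σ : Fin (suc r) → Fin m) → ¬ LinIndep (λ i → M (σ i))
¬LinIndep-rowsFactorThrough {r = r} M cls same σ with pigeonhole (n<1+n r) (cls ∘ σ)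
... | i , j , i<j , clsᵢ≡clsⱼ =
  ¬LinIndep-equalRows (M ∘ σ) (<⇒≢ i<j) (same (σ i) (σ j) clsᵢ≡clsⱼ)

LinIndep-pivot : ∀ {r n} (M : Fin (suc r) → Fin n → Bool) (col : Fin n) →
  M zero col ≡ true → (∀ i → M (suc i) col ≡ false) →
  LinIndep (λ i j → b2q (M (suc i) j)) → LinIndep (λ i j → b2q (M i j))
LinIndep-pivot M col pivot below indep c combination = λ where
    zero    → c₀≡0
    (suc i) → indep (c ∘ suc) tailCombination i
  where
  open ≡-Reasoning
  c₀≡0 : c zero ≡ 0ℚ
  c₀≡0 = begin
    c zero                   ≡⟨ ℚ.*-identityʳ (c zero) ⟨
    c zero *ℚ 1ℚ             ≡⟨ ℚ.+-identityʳ (c zero *ℚ 1ℚ) ⟨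
    c zero *ℚ 1ℚ +ℚ 0ℚ
      ≡⟨ cong₂ (λ b s → c zero *ℚ b2q b +ℚ s) (sym pivot) (sym (sumℚ-zero _ tail≗0)) ⟩
    sumℚ (λ i → c i *ℚ b2q (M i col)) ≡⟨ combination col ⟩
    0ℚ                       ∎
    where
    tail≗0 : ∀ i → c (suc i) *ℚ b2q (M (suc i) col) ≡ 0ℚ
    tail≗0 i = trans (cong (λ b → c (suc i) *ℚ b2q b) (below i)) (ℚ.*-zeroʳ (c (suc i)))
  tailCombination : ∀ j → sumℚ (λ i → c (suc i) *ℚ b2q (M (suc i) j)) ≡ 0ℚ
  tailCombination j = begin
    sumℚ (λ i → c (suc i) *ℚ b2q (M (suc i) j))
      ≡⟨ ℚ.+-identityˡ _ ⟨
    0ℚ +ℚ sumℚ (λ i → c (suc i) *ℚ b2q (M (suc i) j))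
      ≡⟨ cong (_+ℚ sumℚ (λ i → c (suc i) *ℚ b2q (M (suc i) j)))
              (trans (cong (_*ℚ b2q (M zero j)) c₀≡0) (ℚ.*-zeroˡ (b2q (M zero j)))) ⟨
    sumℚ (λ i → c i *ℚ b2q (M i j))
      ≡⟨ combination j ⟩
    0ℚ ∎

Echelon : ∀ {r n} → (Fin r → Fin n → Bool) → (Fin r → Fin n) → Set
Echelon {zero}  M pivots = ⊤
Echelon {suc r} M pivots =
  M zero (pivots zero) ≡ true
  × (∀ i → M (suc i) (pivots zero) ≡ false)
  × Echelon (M ∘ suc) (pivots ∘ suc)

echelon? : ∀ {r n} (M : Fin r → Fin n → Bool) (pivots : Fin r → Fin n) → Dec (Echelon M pivots)
echelon? {zero}  M pivots = yes tt
echelon? {suc r} M pivots =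
  M zero (pivots zero) Bool.≟ true
  ×-dec all? (λ i → M (suc i) (pivots zero) Bool.≟ false)
  ×-dec echelon? (M ∘ suc) (pivots ∘ suc)

LinIndep-echelon : ∀ {r n} (M : Fin r → Fin n → Bool) (pivots : Fin r → Fin n) →
  Echelon M pivots → LinIndep (λ i j → b2q (M i j))
LinIndep-echelon {zero}  M pivots _ c _ ()
LinIndep-echelon {suc r} M pivots (pivot , below , echelon) =
  LinIndep-pivot M (pivots zero) pivot below (LinIndep-echelon (M ∘ suc) (pivots ∘ suc) echelon)

NoIndependentRows : ∀ {n} → (Fin n → Fin n → Bool) → ℕ → Set
NoIndependentRows {n} adj r = (σ : Fin r → Fin n) → ¬ LinIndep (λ i → adjMatrixℚ adj (σ i))

-- The implicit argument is discharged by evaluating echelon?, so a concrete choice of rows and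
-- pivots needs no further proof.
independentRows : ∀ {r n} (adj : Fin n → Fin n → Bool) (σ pivots : Fin r → Fin n) →
  {True (echelon? (adj ∘ σ) pivots)} → LinIndep (λ i → adjMatrixℚ adj (σ i))
independentRows adj σ pivots {echelon} = LinIndep-echelon (adj ∘ σ) pivots (toWitness echelon)

echelonRows-contradiction : ∀ {r n} (adj : Fin n → Fin n → Bool) → NoIndependentRows adj r →
  (σ pivots : Fin r → Fin n) → {True (echelon? (adj ∘ σ) pivots)} → ⊥
echelonRows-contradiction adj noIndep σ pivots {echelon} =
  noIndep σ (independentRows adj σ pivots {echelon})

TriangleFree-2colouring : ∀ {n} (adj : Fin n → Fin n → Bool) (colour : Fin n → Bool) →
  (∀ x y → x ≢ y → adj x y ≡ true → colour x ≢ colour y) → TriangleFree adj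
TriangleFree-2colouring adj colour proper x y z x≢y y≢z x≢z (xy , yz , xz) =
  proper x z x≢z xz (begin
    colour x             ≡⟨ Bool.¬-not (proper x y x≢y xy) ⟩
    not (colour y)       ≡⟨ cong not (Bool.¬-not (proper y z y≢z yz)) ⟩
    not (not (colour z)) ≡⟨ Bool.not-involutive (colour z) ⟩
    colour z             ∎)
  where open ≡-Reasoning

TriangleFree-embed : ∀ {m n} (adj : Fin n → Fin n → Bool) (adj′ : Fin m → Fin m → Bool)
  (ι : Fin m → Fin n) → (∀ x y → ι x ≡ ι y → x ≡ y) →
  (∀ x y → adj′ x y ≡ adj (ι x) (ι y)) → TriangleFree adj → TriangleFree adj′
TriangleFree-embed adj adj′ ι ι-injective adj′≗ triangleFree x y z x≢y y≢z x≢z (xy , yz , xz) =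
  triangleFree (ι x) (ι y) (ι z)
    (x≢y ∘ ι-injective x y) (y≢z ∘ ι-injective y z) (x≢z ∘ ι-injective x z)
    (trans (sym (adj′≗ x y)) xy , trans (sym (adj′≗ y z)) yz , trans (sym (adj′≗ x z)) xz)

NoIndependentRows-embed : ∀ {m n r} (adj : Fin n → Fin n → Bool) (adj′ : Fin m → Fin m → Bool)
  (ι : Fin m → Fin n) → (∀ x y → adj′ x y ≡ adj (ι x) (ι y)) →
  NoIndependentRows adj r → NoIndependentRows adj′ r
NoIndependentRows-embed adj adj′ ι adj′≗ noIndep σ indep = noIndep (ι ∘ σ) λ c combination →
  indep c λ col →
    trans (sumℚ-cong λ i → cong (λ b → c i *ℚ b2q b) (adj′≗ (σ i) col)) (combination (ι col))

splitAt-injective : ∀ m {n} (x y : Fin (m + n)) → splitAt m x ≡ splitAt m y → x ≡ y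
splitAt-injective m {n} x y eq =
  trans (sym (join-splitAt m n x)) (trans (cong (join m n) eq) (join-splitAt m n y))

module _ {k′ k : ℕ} (f : Fin k′ → Fin k) where

  attach : Fin (4 + k′) → Fin (4 + k)
  attach = join 4 k ∘ Sum.map id f ∘ splitAt 4

  adjH-attach : (N : Fin k → Fin 4 → Bool) (N′ : Fin k′ → Fin 4 → Bool) →
    (∀ j p → N′ j p ≡ N (f j) p) → ∀ x y → adjH N′ x y ≡ adjH N (attach x) (attach y)
  adjH-attach N N′ N′≗ x y
    rewrite splitAt-join 4 k (Sum.map id f (splitAt 4 x))
          | splitAt-join 4 k (Sum.map id f (splitAt 4 y))
    = adjSum-map (splitAt 4 x) (splitAt 4 y)
    where
    adjSum-map : ∀ s s′ → adjSum N′ s s′ ≡ adjSum N (Sum.map id f s) (Sum.map id f s′)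
    adjSum-map (inj₁ p) (inj₁ q) = refl
    adjSum-map (inj₁ p) (inj₂ j) = N′≗ j p
    adjSum-map (inj₂ i) (inj₁ q) = N′≗ i q
    adjSum-map (inj₂ i) (inj₂ j) = refl

  attach-injective : (∀ i j → f i ≡ f j → i ≡ j) → ∀ x y → attach x ≡ attach y → x ≡ y
  attach-injective f-injective x y eq =
    splitAt-injective 4 x y (map-injective (splitAt 4 x) (splitAt 4 y)
      (trans (sym (splitAt-join 4 k _)) (trans (cong (splitAt 4) eq) (splitAt-join 4 k _))))
    where
    map-injective : ∀ s s′ → Sum.map id f s ≡ Sum.map id f s′ → s ≡ s′
    map-injective (inj₁ p) (inj₁ q) refl = refl
    map-injective (inj₂ i) (inj₂ j) eq = cong inj₂ (f-injective i j (inj₂-injective eq))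
    map-injective (inj₁ p) (inj₂ j) ()
    map-injective (inj₂ i) (inj₁ q) ()

gS-sym : ∀ p q → gS p q ≡ gS q p
gS-sym 0F = λ { 0F → refl ; 1F → refl ; 2F → refl ; 3F → refl }
gS-sym 1F = λ { 0F → refl ; 1F → refl ; 2F → refl ; 3F → refl }
gS-sym 2F = λ { 0F → refl ; 1F → refl ; 2F → refl ; 3F → refl }
gS-sym 3F = λ { 0F → refl ; 1F → refl ; 2F → refl ; 3F → refl }

gS-properColouring : ∀ p q → p ≢ q → gS p q ≡ true → setAB p ≢ setAB q
gS-properColouring 0F 0F u≢u _ = ⊥-elim (u≢u refl)
gS-properColouring 0F 1F _ _  = λ ()
gS-properColouring 0F 3F _ _  = λ ()
gS-properColouring 1F 0F _ _  = λ ()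
gS-properColouring 1F 2F _ _  = λ ()
gS-properColouring 2F 1F _ _  = λ ()
gS-properColouring 2F 3F _ _  = λ ()
gS-properColouring 3F 0F _ _  = λ ()
gS-properColouring 3F 2F _ _  = λ ()
gS-properColouring 0F 2F _ ()
gS-properColouring 1F 1F _ ()
gS-properColouring 1F 3F _ ()
gS-properColouring 2F 0F _ ()
gS-properColouring 2F 2F _ ()
gS-properColouring 3F 1F _ ()
gS-properColouring 3F 3F _ ()

twinRepresentative : Fin 3 → Fin 4
twinRepresentative 0F = va
twinRepresentative 1F = vu
twinRepresentative 2F = vw

twinClass : Fin 4 → Fin 3
twinClass 0F = 1F
twinClass 1F = 0F
twinClass 2F = 2F
twinClass 3F = 0F

gS-twinClass : ∀ p q → gS p q ≡ gS (twinRepresentative (twinClass p)) q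
gS-twinClass 0F q = refl
gS-twinClass 1F q = refl
gS-twinClass 2F q = refl
gS-twinClass 3F = λ { 0F → refl ; 1F → refl ; 2F → refl ; 3F → refl }

setAB-neighbourhood : ∀ p → setAB p ≡ gS vw p
setAB-neighbourhood = λ { 0F → refl ; 1F → refl ; 2F → refl ; 3F → refl }

setUW-neighbourhood : ∀ p → setUW p ≡ gS va p
setUW-neighbourhood = λ { 0F → refl ; 1F → refl ; 2F → refl ; 3F → refl }

cycleRows-independent : ∀ {k} (N : Fin k → Fin 4 → Bool) →
  LinIndep (λ r → adjMatrixℚ (adjH N) (twinRepresentative r ↑ˡ k))
cycleRows-independent {k} N =
  independentRows (adjH N) (λ r → twinRepresentative r ↑ˡ k) (λ r → lookup (vw ∷ vu ∷ va ∷ []) r ↑ˡ k)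

module FalseTwins {k} (N : Fin k → Fin 4 → Bool) (t : Fin 4) (t-loopless : gS t t ≡ false)
                  (N≗t : ∀ i p → N i p ≡ gS t p) where

  collapse : Fin 4 ⊎ Fin k → Fin 4
  collapse = Sum.[ id , (λ _ → t) ]

  adjSum-collapse : ∀ s s′ → adjSum N s s′ ≡ gS (collapse s) (collapse s′)
  adjSum-collapse (inj₁ p) (inj₁ q) = refl
  adjSum-collapse (inj₁ p) (inj₂ j) = trans (N≗t j p) (gS-sym t p)
  adjSum-collapse (inj₂ i) (inj₁ q) = N≗t i q
  adjSum-collapse (inj₂ i) (inj₂ j) = sym t-loopless

  collapse-edge : ∀ s s′ → s ≢ s′ → adjSum N s s′ ≡ true → collapse s ≢ collapse s′
  collapse-edge (inj₁ p) (inj₁ q) s≢s′ _ = s≢s′ ∘ cong inj₁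
  collapse-edge (inj₁ p) (inj₂ j) _ adj refl = contradiction (trans (sym adj) (trans (N≗t j p) t-loopless)) λ ()
  collapse-edge (inj₂ i) (inj₁ q) _ adj refl = contradiction (trans (sym adj) (trans (N≗t i q) t-loopless)) λ ()
  collapse-edge (inj₂ i) (inj₂ j) _ ()

  vertexClass : Fin (4 + k) → Fin 4
  vertexClass = collapse ∘ splitAt 4

  triangleFree : TriangleFree (adjH N)
  triangleFree = TriangleFree-2colouring (adjH N) (setAB ∘ vertexClass) λ x y x≢y adj →
    gS-properColouring (vertexClass x) (vertexClass y)
      (collapse-edge (splitAt 4 x) (splitAt 4 y) (x≢y ∘ splitAt-injective 4 x y) adj)
      (trans (sym (adjSum-collapse (splitAt 4 x) (splitAt 4 y))) adj)

  sameTwinClass⇒sameRow : ∀ x y → twinClass (vertexClass x) ≡ twinClass (vertexClass y) →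
    ∀ z → adjMatrixℚ (adjH N) x z ≡ adjMatrixℚ (adjH N) y z
  sameTwinClass⇒sameRow x y same z = cong b2q (begin
    adjH N x z                         ≡⟨ adjSum-collapse (splitAt 4 x) (splitAt 4 z) ⟩
    gS (vertexClass x) (vertexClass z) ≡⟨ gS-twinClass (vertexClass x) (vertexClass z) ⟩
    gS (representative x) (vertexClass z)
      ≡⟨ cong (λ r → gS (twinRepresentative r) (vertexClass z)) same ⟩
    gS (representative y) (vertexClass z) ≡⟨ gS-twinClass (vertexClass y) (vertexClass z) ⟨
    gS (vertexClass y) (vertexClass z) ≡⟨ adjSum-collapse (splitAt 4 y) (splitAt 4 z) ⟨
    adjH N y z                         ∎)
    where
    open ≡-Reasoning
    representative : Fin (4 + k) → Fin 4
    representative = twinRepresentative ∘ twinClass ∘ vertexClass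

  rank3 : rankIs (adjH N) 3
  rank3 = ((λ r → twinRepresentative r ↑ˡ k) , cycleRows-independent N)
        , ¬LinIndep-rowsFactorThrough (adjMatrixℚ (adjH N)) (twinClass ∘ vertexClass)
                                      sameTwinClass⇒sameRow

neighbourhood : Bool → Bool → Bool → Bool → Fin 4 → Bool
neighbourhood nu na nw nb 0F = nu
neighbourhood nu na nw nb 1F = na
neighbourhood nu na nw nb 2F = nw
neighbourhood nu na nw nb 3F = nb

neighbourhood-η : (n : Fin 4 → Bool) → ∀ p → neighbourhood (n vu) (n va) (n vw) (n vb) p ≡ n p
neighbourhood-η n = λ { 0F → refl ; 1F → refl ; 2F → refl ; 3F → refl }

oneNewVertex : (Fin 4 → Bool) → Fin 5 → Fin 5 → Bool
oneNewVertex n = adjH {1} (λ _ → n)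

classifyNeighbourhood : ∀ nu na nw nb → let n = neighbourhood nu na nw nb in
  Σ (Fin 4) (λ p → n p ≡ true) → TriangleFree (oneNewVertex n) → NoIndependentRows (oneNewVertex n) 4 →
  (∀ p → n p ≡ setAB p) ⊎ (∀ p → n p ≡ setUW p)
classifyNeighbourhood true true  _    _    _ triangleFree _ =
  ⊥-elim (triangleFree 4F 0F 1F (λ ()) (λ ()) (λ ()) (refl , refl , refl))
classifyNeighbourhood true _     _    true _ triangleFree _ =
  ⊥-elim (triangleFree 4F 0F 3F (λ ()) (λ ()) (λ ()) (refl , refl , refl))
classifyNeighbourhood _    true  true _    _ triangleFree _ =
  ⊥-elim (triangleFree 4F 2F 1F (λ ()) (λ ()) (λ ()) (refl , refl , refl))
classifyNeighbourhood _    _     true true _ triangleFree _ =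
  ⊥-elim (triangleFree 4F 2F 3F (λ ()) (λ ()) (λ ()) (refl , refl , refl))
classifyNeighbourhood false false false false (0F , ()) _ _
classifyNeighbourhood false false false false (1F , ()) _ _
classifyNeighbourhood false false false false (2F , ()) _ _
classifyNeighbourhood false false false false (3F , ()) _ _
classifyNeighbourhood true false false false _ _ noIndep =
  ⊥-elim (echelonRows-contradiction (oneNewVertex (neighbourhood true false false false)) noIndep
  (lookup (0F ∷ 1F ∷ 2F ∷ 4F ∷ [])) (lookup (4F ∷ 2F ∷ 1F ∷ 0F ∷ [])))
classifyNeighbourhood false true false false _ _ noIndep =
  ⊥-elim (echelonRows-contradiction (oneNewVertex (neighbourhood false true false false)) noIndep
  (lookup (1F ∷ 0F ∷ 2F ∷ 4F ∷ [])) (lookup (2F ∷ 0F ∷ 3F ∷ 1F ∷ [])))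
classifyNeighbourhood false false true false _ _ noIndep =
  ⊥-elim (echelonRows-contradiction (oneNewVertex (neighbourhood false false true false)) noIndep
  (lookup (2F ∷ 0F ∷ 1F ∷ 4F ∷ [])) (lookup (4F ∷ 1F ∷ 0F ∷ 2F ∷ [])))
classifyNeighbourhood false false false true _ _ noIndep =
  ⊥-elim (echelonRows-contradiction (oneNewVertex (neighbourhood false false false true)) noIndep
  (lookup (1F ∷ 0F ∷ 2F ∷ 4F ∷ [])) (lookup (2F ∷ 0F ∷ 1F ∷ 3F ∷ [])))
classifyNeighbourhood false true  false true  _ _ _ = inj₁ λ { 0F → refl ; 1F → refl ; 2F → refl ; 3F → refl }
classifyNeighbourhood true  false true  false _ _ _ = inj₂ λ { 0F → refl ; 1F → refl ; 2F → refl ; 3F → refl }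

vertexNeighbourhood : ∀ {k} (N : Fin k → Fin 4 → Bool) (i : Fin k) →
  TriangleFree (adjH N) → NoIndependentRows (adjH N) 4 → Σ (Fin 4) (λ p → N i p ≡ true) →
  (∀ p → N i p ≡ setAB p) ⊎ (∀ p → N i p ≡ setUW p)
vertexNeighbourhood N i triangleFree noIndep (p , Nᵢp) =
  Sum.map (λ n≗AB q → trans (sym (η q)) (n≗AB q)) (λ n≗UW q → trans (sym (η q)) (n≗UW q))
    (classifyNeighbourhood (N i vu) (N i va) (N i vw) (N i vb) (p , trans (η p) Nᵢp)
      (TriangleFree-embed (adjH N) _ ι (attach-injective (λ _ → i) λ { 0F 0F _ → refl })
                          embedding triangleFree)
      (NoIndependentRows-embed (adjH N) _ ι embedding noIndep))
  where
  η = neighbourhood-η (N i)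
  ι = attach (λ _ → i)
  embedding = adjH-attach (λ _ → i) N _ (λ _ → η)

mixedNeighbourhoods : Fin 2 → Fin 4 → Bool
mixedNeighbourhoods 0F = setAB
mixedNeighbourhoods 1F = setUW

neighbourhoodsNotMixed : ∀ {k} (N : Fin k → Fin 4 → Bool) → NoIndependentRows (adjH N) 4 →
  ∀ i j → (∀ p → N i p ≡ setAB p) → (∀ p → N j p ≡ setUW p) → ⊥
neighbourhoodsNotMixed N noIndep i j Nᵢ≗AB Nⱼ≗UW =
  echelonRows-contradiction (adjH mixedNeighbourhoods)
    (NoIndependentRows-embed (adjH N) (adjH mixedNeighbourhoods) (attach (lookup (i ∷ j ∷ []))) embedding noIndep)
    (lookup (5F ∷ 0F ∷ 2F ∷ 4F ∷ [])) (lookup (2F ∷ 0F ∷ 5F ∷ 1F ∷ []))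
  where
  embedding = adjH-attach (lookup (i ∷ j ∷ [])) N mixedNeighbourhoods λ where
    0F p → sym (Nᵢ≗AB p)
    1F p → sym (Nⱼ≗UW p)

uniformChoice : ∀ {k} {P Q : Fin k → Set} → (∀ i → P i ⊎ Q i) → (∀ i j → P i → Q j → ⊥) →
  (∀ i → P i) ⊎ (∀ i → Q i)
uniformChoice {zero}  choice mixed = inj₁ λ ()
uniformChoice {suc k} choice mixed with choice zero
... | inj₁ P₀ = inj₁ λ i → Sum.[ id , (λ Qᵢ → ⊥-elim (mixed zero i P₀ Qᵢ)) ] (choice i)
... | inj₂ Q₀ = inj₂ λ i → Sum.[ (λ Pᵢ → ⊥-elim (mixed i zero Pᵢ Q₀)) , id ] (choice i)

mainTheorem2 : (k : ℕ) (N : Fin k → Fin 4 → Bool) →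
    (∀ (i : Fin k) → Σ (Fin 4) (λ p → N i p ≡ true)) →
    ((TriangleFree (adjH N) × rankIs (adjH N) 3) ⇔
     ((∀ (i : Fin k) (p : Fin 4) → N i p ≡ setAB p)
      ⊎ (∀ (i : Fin k) (p : Fin 4) → N i p ≡ setUW p)))
mainTheorem2 k N nonempty = mk⇔ classify realise
  where
  TriangleFreeRank3 : Set
  TriangleFreeRank3 = TriangleFree (adjH N) × rankIs (adjH N) 3
  Joined : (Fin 4 → Bool) → Set
  Joined A = ∀ i p → N i p ≡ A p

  classify : TriangleFreeRank3 → Joined setAB ⊎ Joined setUW
  classify (triangleFree , _ , noIndep) =
    uniformChoice (λ i → vertexNeighbourhood N i triangleFree noIndep (nonempty i))
                  (neighbourhoodsNotMixed N noIndep)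

  falseTwinsOf : ∀ t → gS t t ≡ false → Joined (gS t) → TriangleFreeRank3
  falseTwinsOf t loopless N≗t = let open FalseTwins N t loopless N≗t in triangleFree , rank3

  realise : Joined setAB ⊎ Joined setUW → TriangleFreeRank3
  realise (inj₁ N≗AB) = falseTwinsOf vw refl λ i p → trans (N≗AB i p) (setAB-neighbourhood p)
  realise (inj₂ N≗UW) = falseTwinsOf va refl λ i p → trans (N≗UW i p) (setUW-neighbourhood p)
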